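{- Let $H$ and $G$ be graphs. If $H$ is a minor of $G$, then there exists a combinatorial embedding of $H$ into $G$.
   Context: All graphs are finite and simple. $H$ is a minor of $G$ if a graph isomorphic to $H$ can be obtained from $G$ by repeatedly deleting vertices, deleting edges and contracting edges. A combinatorial embedding of a graph $\Gamma=(V,E)$ into a graph $Y$ is a map $f$ assigning to each vertex $v\in V$ a vertex $fv\in V(Y)$ and to each edge $e=uv\in E$ a walk $f_e$ in $Y$ (a "road") with endpoints $fu$ and $fv$, such that: (1) $f|_V$ is injective; (2) for any two distinct edges $e,t\in E$ sharing no endpoint, the vertex sets of $f_e$ and $f_t$ are disjoint; (3) for every edge $e\in E$ and every vertex $v\notin e$, $fv$ is not a vertex of $f_e$. -}

module Defs where

open import Data.Nat using (ℕ; suc)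
open import Data.Bool using (Bool; true; false; _∧_; _∨_; not)
open import Data.Fin using (Fin; punchIn; _<_)
open import Data.Fin.Properties using (_≟_)
open import Data.List using (List; []; _∷_)
open import Data.List.Membership.Propositional using (_∈_)
open import Data.Product using (Σ; _×_; _,_)
open import Relation.Nullary using (¬_)
open import Relation.Nullary.Decidable using (⌊_⌋)
open import Relation.Binary.PropositionalEquality using (_≡_; _≢_)
open import Function.Bundles using (_⤖_; Bijection)

RawGraph : ℕ → Set
RawGraph n = Fin n → Fin n → Bool

record IsSimple {n : ℕ} (G : RawGraph n) : Set where
  field
    symmetric : ∀ i j → G i j ≡ G j i
    loopless  : ∀ i → G i i ≡ false

record Iso {m n : ℕ} (H : RawGraph m) (G : RawGraph n) : Set where
  field
    bij      : Fin m ⤖ Fin n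
    preserve : ∀ i j → H i j ≡ G (Bijection.to bij i) (Bijection.to bij j)

_==_ : {n : ℕ} → Fin n → Fin n → Bool
i == j = ⌊ i ≟ j ⌋

deleteVertex : {m : ℕ} → RawGraph (suc m) → Fin (suc m) → RawGraph m
deleteVertex G v i j = G (punchIn v i) (punchIn v j)

deleteEdge : {n : ℕ} → RawGraph n → Fin n → Fin n → RawGraph n
deleteEdge G u v i j =
  G i j ∧ not (((i == u) ∧ (j == v)) ∨ ((i == v) ∧ (j == u)))

-- contract the edge uv: vertex v is removed and merged into u;
-- the remaining vertices are renumbered via punchIn v.
-- The merged vertex is adjacent to the old neighbours of u and of v;
-- no loops or multiple edges are created.
contractEdge : {m : ℕ} → RawGraph (suc m) → Fin (suc m) → Fin (suc m) → RawGraph m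
contractEdge G u v i j =
  not (i == j) ∧
  (G a b ∨ (((a == u) ∧ G v b) ∨ ((b == u) ∧ G v a)))
  where
  a = punchIn v i
  b = punchIn v j

data Obtainable {n : ℕ} (G : RawGraph n) : {k : ℕ} → RawGraph k → Set where
  done    : Obtainable G G
  delV    : ∀ {m} {K : RawGraph (suc m)} →
            Obtainable G K → (v : Fin (suc m)) →
            Obtainable G (deleteVertex K v)
  delE    : ∀ {m} {K : RawGraph m} →
            Obtainable G K → (u v : Fin m) → K u v ≡ true →
            Obtainable G (deleteEdge K u v)
  contr   : ∀ {m} {K : RawGraph (suc m)} →
            Obtainable G K → (u v : Fin (suc m)) → u ≢ v → K u v ≡ true →
            Obtainable G (contractEdge K u v)

Minor : {m n : ℕ} → RawGraph m → RawGraph n → Set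
Minor {m} H G = Σ ℕ λ k → Σ (RawGraph k) λ K → Obtainable G K × Iso H K

data Walk {n : ℕ} (Y : RawGraph n) : Fin n → Fin n → Set where
  [_]    : (x : Fin n) → Walk Y x x
  _∷⟨_⟩_ : ∀ {y z} (x : Fin n) → Y x y ≡ true → Walk Y y z → Walk Y x z

vertices : {n : ℕ} {Y : RawGraph n} {x y : Fin n} → Walk Y x y → List (Fin n)
vertices [ x ] = x ∷ []
vertices (x ∷⟨ _ ⟩ w) = x ∷ vertices w

-- Combinatorial embedding of Γ into Y.
-- Each (unordered) edge uv of Γ is represented once, as the pair u < v.

record CombEmbedding {m n : ℕ} (Γ : RawGraph m) (Y : RawGraph n) : Set where
  field
    f     : Fin m → Fin n
    road  : (u v : Fin m) → u < v → Γ u v ≡ true → Walk Y (f u) (f v)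
    inj   : ∀ u v → f u ≡ f v → u ≡ v
    disj  : ∀ u v (p : u < v) (e : Γ u v ≡ true)
              u' v' (p' : u' < v') (e' : Γ u' v' ≡ true) →
              u ≢ u' → u ≢ v' → v ≢ u' → v ≢ v' →
              ∀ x → x ∈ vertices (road u v p e) → ¬ (x ∈ vertices (road u' v' p' e'))
    avoid : ∀ u v (p : u < v) (e : Γ u v ≡ true) w →
              w ≢ u → w ≢ v → ¬ (f w ∈ vertices (road u v p e))

-- A minor H of G has a model in G: disjoint branch sets B h ⊆ V(G), one per vertex h of H,
-- with a centre in each, such that every edge hh' of H is realised by a walk between the
-- centres running inside B h ∪ B h'. Sending h to its centre and hh' to that walk is a
-- combinatorial embedding, since branch sets of distinct vertices are disjoint. Models
-- exist because G models itself (B h = {h}) and every minor operation transforms a model of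
-- K into one of the smaller graph: deletions restrict it, and contracting uv merges B v into B u.
module Submission where

open import Defs
open import Data.Nat using (ℕ; suc)
open import Data.Bool using (true; false; _∧_; _∨_)
open import Data.Bool.Properties using (T-≡)
open import Data.Fin using (Fin; punchIn)
open import Data.Fin.Properties using (punchIn-injective; punchInᵢ≢i)
open import Data.List.Membership.Propositional using (_∈_)
open import Data.List.Relation.Unary.All as All using (All; []; _∷_)
open import Data.Product using (_×_; _,_; proj₁)
open import Data.Sum as Sum using (_⊎_; inj₁; inj₂; [_,_]′)
open import Data.Empty using (⊥-elim)
open import Level using (Level; 0ℓ)
open import Relation.Nullary.Decidable using (toWitness)
open import Relation.Unary using (Pred; _⊆_; _∪_)
open import Relation.Binary.PropositionalEquality using (_≡_; _≢_; refl; sym; trans; subst)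
open import Function using (_∘_; id)
open import Function.Bundles using (Bijection; Equivalence)
open import Function.Definitions using (Injective)

∧-≡-true : ∀ x {y} → x ∧ y ≡ true → x ≡ true × y ≡ true
∧-≡-true true p = refl , p

∨-≡-true : ∀ x {y} → x ∨ y ≡ true → x ≡ true ⊎ y ≡ true
∨-≡-true true  _ = inj₁ refl
∨-≡-true false p = inj₂ p

==-≡-true : ∀ {n} {i j : Fin n} → (i == j) ≡ true → i ≡ j
==-≡-true = toWitness ∘ Equivalence.from T-≡

contractEdge-true : ∀ {m} (K : RawGraph (suc m)) u v i j →
  let a = punchIn v i ; b = punchIn v j in
  contractEdge K u v i j ≡ true →
  K a b ≡ true ⊎ (a ≡ u × K v b ≡ true) ⊎ (b ≡ u × K v a ≡ true)
contractEdge-true K u v i j e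
  with ∧-≡-true _ e
... | _ , e′ with ∨-≡-true (K (punchIn v i) (punchIn v j)) e′
... | inj₁ ab = inj₁ ab
... | inj₂ e″ with ∨-≡-true ((punchIn v i == u) ∧ _) e″
... | inj₁ e‴ = let a≡u , vb = ∧-≡-true (punchIn v i == u) e‴ in inj₂ (inj₁ (==-≡-true a≡u , vb))
... | inj₂ e‴ = let b≡u , va = ∧-≡-true (punchIn v j == u) e‴ in inj₂ (inj₂ (==-≡-true b≡u , va))

module _ {n : ℕ} {G : RawGraph n} where

  _++ʷ_ : ∀ {x y z} → Walk G x y → Walk G y z → Walk G x z
  [ _ ]        ++ʷ w′ = w′
  (x ∷⟨ e ⟩ w) ++ʷ w′ = x ∷⟨ e ⟩ (w ++ʷ w′)

  All-++ʷ : ∀ {ℓ} {P : Pred (Fin n) ℓ} {x y z} (w : Walk G x y) {w′ : Walk G y z} →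
            All P (vertices w) → All P (vertices w′) → All P (vertices (w ++ʷ w′))
  All-++ʷ [ _ ]        _         pw′ = pw′
  All-++ʷ (_ ∷⟨ _ ⟩ w) (px ∷ pw) pw′ = px ∷ All-++ʷ w pw pw′

  All-start : ∀ {ℓ} {P : Pred (Fin n) ℓ} {x y} (w : Walk G x y) → All P (vertices w) → P x
  All-start [ _ ]        (px ∷ []) = px
  All-start (_ ∷⟨ _ ⟩ _) (px ∷ _)  = px

  module _ (symmetric : ∀ x y → G x y ≡ G y x) where

    reverseʷ : ∀ {x y} → Walk G x y → Walk G y x
    reverseʷ [ x ]              = [ x ]
    reverseʷ (_∷⟨_⟩_ {y} x e w) = reverseʷ w ++ʷ (y ∷⟨ trans (symmetric y x) e ⟩ [ x ])

    All-reverseʷ : ∀ {ℓ} {P : Pred (Fin n) ℓ} {x y} (w : Walk G x y) →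
                   All P (vertices w) → All P (vertices (reverseʷ w))
    All-reverseʷ [ _ ]        (px ∷ []) = px ∷ []
    All-reverseʷ (_ ∷⟨ _ ⟩ w) (px ∷ pw) =
      All-++ʷ (reverseʷ w) (All-reverseʷ w pw) (All-start w pw ∷ px ∷ [])

record WalkIn {n ℓ} (G : RawGraph n) (P : Pred (Fin n) ℓ) (x y : Fin n) : Set ℓ where
  constructor _⊣_
  field
    walk   : Walk G x y
    inside : All P (vertices walk)

open WalkIn

module _ {n : ℕ} {G : RawGraph n} {ℓ : Level} {P : Pred (Fin n) ℓ} where

  edgeIn : ∀ {x y} → G x y ≡ true → P x → P y → WalkIn G P x y
  edgeIn {x} {y} e px py = (x ∷⟨ e ⟩ [ y ]) ⊣ (px ∷ py ∷ [])

  _++ᵂ_ : ∀ {x y z} → WalkIn G P x y → WalkIn G P y z → WalkIn G P x z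
  (w ⊣ pw) ++ᵂ (w′ ⊣ pw′) = (w ++ʷ w′) ⊣ All-++ʷ w pw pw′

  reverseᵂ : (∀ x y → G x y ≡ G y x) → ∀ {x y} → WalkIn G P x y → WalkIn G P y x
  reverseᵂ symmetric (w ⊣ pw) = reverseʷ symmetric w ⊣ All-reverseʷ symmetric w pw

  mapᵂ : ∀ {ℓ′} {Q : Pred (Fin n) ℓ′} → P ⊆ Q → ∀ {x y} → WalkIn G P x y → WalkIn G Q x y
  mapᵂ P⊆Q (w ⊣ pw) = w ⊣ All.map P⊆Q pw

record Model {n k : ℕ} (G : RawGraph n) (K : RawGraph k) : Set₁ where
  field
    Branch   : Fin k → Pred (Fin n) 0ℓ
    disjoint : ∀ {h h′ x} → Branch h x → Branch h′ x → h ≡ h′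
    centre   : Fin k → Fin n
    centre∈  : ∀ h → Branch h (centre h)
    link     : ∀ {h h′} → K h h′ ≡ true → WalkIn G (Branch h ∪ Branch h′) (centre h) (centre h′)

  ∪-branch : ∀ {h h′ l x} → (Branch h ∪ Branch h′) x → Branch l x → l ≡ h ⊎ l ≡ h′
  ∪-branch (inj₁ bh)  bl = inj₁ (disjoint bl bh)
  ∪-branch (inj₂ bh′) bl = inj₂ (disjoint bl bh′)

  ∈-link : ∀ {h h′ x} (e : K h h′ ≡ true) → x ∈ vertices (walk (link e)) → (Branch h ∪ Branch h′) x
  ∈-link e = All.lookup (inside (link e))

open Model

module _ {n : ℕ} {G : RawGraph n} where

  selfModel : Model G G
  selfModel = record
    { Branch   = λ h x → x ≡ h
    ; disjoint = λ x≡h x≡h′ → trans (sym x≡h) x≡h′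
    ; centre   = id
    ; centre∈  = λ _ → refl
    ; link     = λ e → edgeIn e (inj₁ refl) (inj₂ refl)
    }

  pullback : ∀ {k k′} {K : RawGraph k} {K′ : RawGraph k′} (σ : Fin k′ → Fin k) →
             Injective _≡_ _≡_ σ → (∀ i j → K′ i j ≡ true → K (σ i) (σ j) ≡ true) →
             Model G K → Model G K′
  pullback σ σ-injective σ-edge M = record
    { Branch   = Branch M ∘ σ
    ; disjoint = λ bi bj → σ-injective (disjoint M bi bj)
    ; centre   = centre M ∘ σ
    ; centre∈  = centre∈ M ∘ σ
    ; link     = λ {i} {j} e → link M (σ-edge i j e)
    }

  module Contraction {m} {K : RawGraph (suc m)} (symmetric : ∀ x y → G x y ≡ G y x)
                     (M : Model G K) (u v : Fin (suc m)) (uv : K u v ≡ true) where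

    Merged : Fin (suc m) → Pred (Fin n) 0ℓ
    Merged h x = Branch M h x ⊎ (h ≡ u × Branch M v x)

    merged-disjoint : ∀ {a b x} → a ≢ v → b ≢ v → Merged a x → Merged b x → a ≡ b
    merged-disjoint _   _   (inj₁ ba)        (inj₁ bb)        = disjoint M ba bb
    merged-disjoint a≢v _   (inj₁ ba)        (inj₂ (_ , bv))  = ⊥-elim (a≢v (disjoint M ba bv))
    merged-disjoint _   b≢v (inj₂ (_ , bv))  (inj₁ bb)        = ⊥-elim (b≢v (disjoint M bb bv))
    merged-disjoint _   _   (inj₂ (a≡u , _)) (inj₂ (b≡u , _)) = trans a≡u (sym b≡u)

    linkVia-v : ∀ {b} → K v b ≡ true → WalkIn G (Merged u ∪ Merged b) (centre M u) (centre M b)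
    linkVia-v vb = mapᵂ (inj₁ ∘ [ inj₁ , v⊆u ]′) (link M uv) ++ᵂ mapᵂ (Sum.map v⊆u inj₁) (link M vb)
      where v⊆u : Branch M v ⊆ Merged u
            v⊆u bv = inj₂ (refl , bv)

    mergedLink : ∀ {a b} → K a b ≡ true ⊎ (a ≡ u × K v b ≡ true) ⊎ (b ≡ u × K v a ≡ true) →
                 WalkIn G (Merged a ∪ Merged b) (centre M a) (centre M b)
    mergedLink (inj₁ ab)                = mapᵂ (Sum.map inj₁ inj₁) (link M ab)
    mergedLink (inj₂ (inj₁ (refl , vb))) = linkVia-v vb
    mergedLink (inj₂ (inj₂ (refl , va))) = reverseᵂ symmetric (mapᵂ Sum.swap (linkVia-v va))

    model : Model G (contractEdge K u v)
    model = record
      { Branch   = Merged ∘ punchIn v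
      ; disjoint = λ {i} {j} bi bj →
          punchIn-injective v i j (merged-disjoint (punchInᵢ≢i v i) (punchInᵢ≢i v j) bi bj)
      ; centre   = centre M ∘ punchIn v
      ; centre∈  = λ i → inj₁ (centre∈ M (punchIn v i))
      ; link     = λ {i} {j} e → mergedLink (contractEdge-true K u v i j e)
      }

  obtainable⇒model : IsSimple G → ∀ {k} {K : RawGraph k} → Obtainable G K → Model G K
  obtainable⇒model _  done                     = selfModel
  obtainable⇒model sG (delV K≼G v)             = pullback (punchIn v) (punchIn-injective v _ _)
                                                (λ _ _ → id) (obtainable⇒model sG K≼G)
  obtainable⇒model sG (delE {K = K} K≼G _ _ _) = pullback id id (λ i j → proj₁ ∘ ∧-≡-true (K i j))
                                                (obtainable⇒model sG K≼G)
  obtainable⇒model sG (contr K≼G u v _ uv) =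
    Contraction.model (IsSimple.symmetric sG) (obtainable⇒model sG K≼G) u v uv

  iso-pullback : ∀ {m k} {H : RawGraph m} {K : RawGraph k} → Iso H K → Model G K → Model G H
  iso-pullback H≅K = pullback (Bijection.to bij) (Bijection.injective bij)
                              (λ i j e → trans (sym (Iso.preserve H≅K i j)) e)
    where bij = Iso.bij H≅K

  model⇒embedding : ∀ {m} {H : RawGraph m} → Model G H → CombEmbedding H G
  model⇒embedding M = record
    { f     = centre M
    ; road  = λ _ _ _ e → walk (link M e)
    ; inj   = λ u v fu≡fv → disjoint M (centre∈ M u) (subst (Branch M v) (sym fu≡fv) (centre∈ M v))
    ; disj  = λ u v _ e u′ v′ _ e′ u≢u′ u≢v′ v≢u′ v≢v′ x x∈ x∈′ →
        [ (λ bu′ → [ u≢u′ ∘ sym , v≢u′ ∘ sym ]′ (∪-branch M (∈-link M e x∈) bu′))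
        , (λ bv′ → [ u≢v′ ∘ sym , v≢v′ ∘ sym ]′ (∪-branch M (∈-link M e x∈) bv′))
        ]′ (∈-link M e′ x∈′)
    ; avoid = λ u v _ e w w≢u w≢v fw∈ →
        [ w≢u , w≢v ]′ (∪-branch M (∈-link M e fw∈) (centre∈ M w))
    }

mainTheorem6 : {m n : ℕ} (H : RawGraph m) (G : RawGraph n) →
    IsSimple H → IsSimple G → Minor H G → CombEmbedding H G
mainTheorem6 H G _ sG (_ , K , K≼G , H≅K) =
  model⇒embedding (iso-pullback H≅K (obtainable⇒model sG K≼G))
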